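{- Let $L,m$ be integers with $1<m\le 2^L$, let $l=\lceil\log_2 m\rceil$, and let $(\beta_1,\dots,\beta_{2^L})$ be a Cantor basis of ${\rm GF}(2^{2^L})$ over ${\rm GF}(2)$, with $W_i$ and $\varpi_u$ as in the context. Let $b\in W_{2^L}\setminus W_{m-2^{l-1}}$. Let $r_0,\dots,r_{2^{m-2^{l-1}}-1}$ be polynomials over ${\rm GF}(2^{2^L})$ of degree $<2^{2^{l-1}}$, written $r_j(x)=\sum_{i=0}^{2^{2^{l-1}}-1}r_{ij}x^i$. For $0\le i<2^{2^{l-1}}$ let $t_i$ be a polynomial over ${\rm GF}(2^{2^L})$ of degree $<2^{2^{l-1}}$ with $t_i(b+\varpi_j)=r_{ij}$ for all $0\le j<2^{m-2^{l-1}}$. If $f$ is the polynomial whose Gao–Mateer polynomials at $x^{2^{2^{l-1}}}-x$ are $(t_0,\dots,t_{2^{2^{l-1}}-1})$, i.e. $f(x)=\sum_{i=0}^{2^{2^{l-1}}-1}x^i t_i(x^{2^{2^{l-1}}}-x)$, then the remainder of $f$ modulo $x^{2^{2^{l-1}}}-x-(b+\varpi_j)$ is $r_j$ for $j=0,\dots,2^{m-2^{l-1}}-1$.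
   Context: A Cantor basis of ${\rm GF}(2^{2^L})$ over ${\rm GF}(2)$ is a ${\rm GF}(2)$-basis $(\beta_1,\dots,\beta_{2^L})$ with $\beta_1=1$ and $\beta_i^2-\beta_i=\beta_{i-1}$ for $i>1$. $W_i=\sum_{t=1}^i{\rm GF}(2)\beta_t$. For $0\le u<2^{2^L}$ with binary digits $u=\sum_t u_t2^t$, $\varpi_u=\sum_t u_t\beta_{t+1}$. -}

module Defs where

open import Level using (Level; _⊔_)
open import Algebra.Bundles using (CommutativeRing)
open import Data.Nat as ℕ using (ℕ; zero; suc; _∸_; _^_; _≤_; _<_; _≡ᵇ_)
open import Data.Nat.DivMod using (_/_; _%_)
open import Data.Nat.Logarithm using (⌈log₂_⌉)
open import Data.Bool using (Bool; true; false; if_then_else_)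
open import Data.Fin using (Fin; toℕ) renaming (zero to fzero; suc to fsuc)
open import Data.List as List using (List; []; _∷_)
open import Data.Product using (Σ; ∃; _×_; _,_)
open import Relation.Binary.PropositionalEquality using (_≡_)
open import Relation.Nullary using (¬_)

record Field (c ℓ : Level) : Set (Level.suc (c ⊔ ℓ)) where
  field
    commutativeRing : CommutativeRing c ℓ
  open CommutativeRing commutativeRing public
  field
    1≉0     : ¬ (1# ≈ 0#)
    inverse : ∀ x → ¬ (x ≈ 0#) → ∃ λ y → x * y ≈ 1#

bit : ℕ → ℕ → Bool
bit u zero    = (u % 2) ≡ᵇ 1
bit u (suc t) = bit (u / 2) t

ℓ-of : ℕ → ℕ
ℓ-of m = ⌈log₂ m ⌉

half : ℕ → ℕ
half m = 2 ^ (ℓ-of m ∸ 1)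

module FieldTheory {c ℓ : Level} (F : Field c ℓ) where
  open Field F

  ∑ : (n : ℕ) → (Fin n → Carrier) → Carrier
  ∑ zero    f = 0#
  ∑ (suc n) f = f fzero + ∑ n (λ i → f (fsuc i))

  -- GF(2)-scalar action: a Bool is an element of GF(2)
  _·_ : Bool → Carrier → Carrier
  true  · x = x
  false · x = 0#

  sq : Carrier → Carrier
  sq x = x * x

  -- Cantor basis (β_1,…,β_n) of F over GF(2), written 0-indexed:
  -- β 0 = 1, β(i+1)^2 - β(i+1) = β i, and β is a GF(2)-basis of F.
  record IsCantorBasis (n : ℕ) (β : Fin n → Carrier) : Set (c ⊔ ℓ) where
    field
      char2      : 1# + 1# ≈ 0#
      first      : (i : Fin n) → toℕ i ≡ 0 → β i ≈ 1#
      recurrence : (i : Fin n) (j : Fin n) → toℕ j ≡ suc (toℕ i) →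
                   sq (β j) - β j ≈ β i
      spanning   : ∀ x → ∃ λ (a : Fin n → Bool) → x ≈ ∑ n (λ t → a t · β t)
      independent : ∀ (a : Fin n → Bool) → ∑ n (λ t → a t · β t) ≈ 0# →
                    ∀ t → a t ≡ false

  -- W_i = GF(2)-span of β_1,…,β_i  (0-indexed: β t with t < i)
  InW : (n : ℕ) → (Fin n → Carrier) → ℕ → Carrier → Set ℓ
  InW n β i x = ∃ λ (a : Fin n → Bool) →
                  (∀ t → i ≤ toℕ t → a t ≡ false) × (x ≈ ∑ n (λ t → a t · β t))

  -- ϖ_u = Σ_t u_t β_{t+1}  (0-indexed: Σ_t bit u t · β t)
  ϖ : (n : ℕ) → (Fin n → Carrier) → ℕ → Carrier
  ϖ n β u = ∑ n (λ t → bit u (toℕ t) · β t)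

  -- Polynomials over F as coefficient lists (constant term first)
  Poly : Set c
  Poly = List Carrier

  coeff : Poly → ℕ → Carrier
  coeff []       _       = 0#
  coeff (a ∷ p)  zero    = a
  coeff (a ∷ p)  (suc n) = coeff p n

  _≈ₚ_ : Poly → Poly → Set ℓ
  p ≈ₚ q = ∀ n → coeff p n ≈ coeff q n

  DegLT : Poly → ℕ → Set ℓ
  DegLT p d = ∀ n → d ≤ n → coeff p n ≈ 0#

  HasDegree : Poly → ℕ → Set ℓ
  HasDegree p d = ¬ (coeff p d ≈ 0#) × DegLT p (suc d)

  _+ₚ_ : Poly → Poly → Poly
  []      +ₚ q       = q
  (a ∷ p) +ₚ []      = a ∷ p
  (a ∷ p) +ₚ (b ∷ q) = (a + b) ∷ (p +ₚ q)

  -ₚ_ : Poly → Poly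
  -ₚ p = List.map -_ p

  _-ₚ_ : Poly → Poly → Poly
  p -ₚ q = p +ₚ (-ₚ q)

  scale : Carrier → Poly → Poly
  scale a p = List.map (a *_) p

  _*ₚ_ : Poly → Poly → Poly
  []      *ₚ q = []
  (a ∷ p) *ₚ q = scale a q +ₚ (0# ∷ (p *ₚ q))

  const : Carrier → Poly
  const a = a ∷ []

  X : Poly
  X = 0# ∷ 1# ∷ []

  X^ : ℕ → Poly
  X^ zero    = const 1#
  X^ (suc i) = X *ₚ X^ i

  eval : Poly → Carrier → Carrier
  eval []      x = 0#
  eval (a ∷ p) x = a + x * eval p x

  compose : Poly → Poly → Poly
  compose []      q = []
  compose (a ∷ p) q = const a +ₚ (q *ₚ compose p q)

  ∑ₚ : (n : ℕ) → (Fin n → Poly) → Poly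
  ∑ₚ zero    f = []
  ∑ₚ (suc n) f = f fzero +ₚ ∑ₚ n (λ i → f (fsuc i))

  fromCoeffs : (K : ℕ) → (Fin K → Carrier) → Poly
  fromCoeffs K a = List.tabulate a

  IsRemainder : Poly → Poly → Poly → Set (c ⊔ ℓ)
  IsRemainder f g r =
    (∃ λ (q : Poly) → f ≈ₚ ((q *ₚ g) +ₚ r)) × (∀ d → HasDegree g d → DegLT r d)

-- Write Y = X^K − X and G = Y − x. Modulo G the polynomial Y is congruent to the constant x, so
-- t_i(Y) ≡ t_i(x) = r_i and f = Σ X^i t_i(Y) ≡ Σ r_i X^i. This polynomial has degree < K = deg G,
-- hence it is the remainder.
module Submission where

open import Defs
open import Level using (_⊔_)
open import Data.Nat using (ℕ; zero; suc; _∸_; _^_; _≤_; _<_; s≤s)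
import Data.Nat.Properties as ℕ
open import Data.Fin using (Fin; toℕ) renaming (zero to fzero; suc to fsuc)
open import Data.List using ([]; _∷_)
open import Data.Product using (_,_)
open import Data.Empty using (⊥-elim)
open import Relation.Binary.PropositionalEquality as ≡ using (_≡_)
open import Relation.Binary.Definitions using (tri<; tri≈; tri>)
open import Relation.Nullary using (¬_)
import Algebra.Properties.CommutativeSemigroup as CommutativeSemigroupProperties
import Algebra.Properties.Ring as RingProperties
import Relation.Binary.Reasoning.Setoid as SetoidReasoning

module Polynomials {c ℓ} (F : Field c ℓ) where
  open Field F hiding (zero)
  open FieldTheory F
  open SetoidReasoning setoid
  open CommutativeSemigroupProperties +-commutativeSemigroup using (interchange)
  open RingProperties ring using (-0#≈0#)

  -- Coefficientwise equality ≈ₚ as a record, so that the compared polynomials can be inferred.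
  infix 4 _≋_
  record _≋_ (p q : Poly) : Set ℓ where
    constructor mk≋
    field at : ∀ n → coeff p n ≈ coeff q n
  open _≋_ public

  ≋-refl : ∀ {p} → p ≋ p
  ≋-refl .at n = refl

  ≋-sym : ∀ {p q} → p ≋ q → q ≋ p
  ≋-sym e .at n = sym (e .at n)

  ≋-trans : ∀ {p q r} → p ≋ q → q ≋ r → p ≋ r
  ≋-trans e f .at n = trans (e .at n) (f .at n)

  ∷-cong : ∀ {a b p q} → a ≈ b → p ≋ q → (a ∷ p) ≋ (b ∷ q)
  ∷-cong e f .at zero    = e
  ∷-cong e f .at (suc n) = f .at n

  []≋0∷[] : [] ≋ (0# ∷ [])
  []≋0∷[] .at zero    = refl
  []≋0∷[] .at (suc n) = refl

  coeff-+ₚ : ∀ p q n → coeff (p +ₚ q) n ≈ coeff p n + coeff q n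
  coeff-+ₚ []      q       n       = sym (+-identityˡ _)
  coeff-+ₚ (a ∷ p) []      n       = sym (+-identityʳ _)
  coeff-+ₚ (a ∷ p) (b ∷ q) zero    = refl
  coeff-+ₚ (a ∷ p) (b ∷ q) (suc n) = coeff-+ₚ p q n

  coeff-map : ∀ (f : Carrier → Carrier) → f 0# ≈ 0# →
              ∀ p n → coeff (Data.List.map f p) n ≈ f (coeff p n)
  coeff-map f f0≈0 []      n       = sym f0≈0
  coeff-map f f0≈0 (a ∷ p) zero    = refl
  coeff-map f f0≈0 (a ∷ p) (suc n) = coeff-map f f0≈0 p n

  coeff-scale : ∀ a p n → coeff (scale a p) n ≈ a * coeff p n
  coeff-scale a = coeff-map (a *_) (zeroʳ a)

  coeff-negₚ : ∀ p n → coeff (-ₚ p) n ≈ - coeff p n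
  coeff-negₚ = coeff-map -_ -0#≈0#

  +ₚ-cong : ∀ {p p′ q q′} → p ≋ p′ → q ≋ q′ → (p +ₚ q) ≋ (p′ +ₚ q′)
  +ₚ-cong {p} {p′} {q} {q′} e f .at n = begin
    coeff (p +ₚ q) n      ≈⟨ coeff-+ₚ p q n ⟩
    coeff p n + coeff q n   ≈⟨ +-cong (e .at n) (f .at n) ⟩
    coeff p′ n + coeff q′ n ≈⟨ coeff-+ₚ p′ q′ n ⟨
    coeff (p′ +ₚ q′) n    ∎

  +ₚ-identityʳ : ∀ p → (p +ₚ []) ≋ p
  +ₚ-identityʳ p .at n = trans (coeff-+ₚ p [] n) (+-identityʳ _)

  +ₚ-assoc : ∀ p q r → ((p +ₚ q) +ₚ r) ≋ (p +ₚ (q +ₚ r))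
  +ₚ-assoc p q r .at n = begin
    coeff ((p +ₚ q) +ₚ r) n             ≈⟨ coeff-+ₚ (p +ₚ q) r n ⟩
    coeff (p +ₚ q) n + coeff r n         ≈⟨ +-congʳ (coeff-+ₚ p q n) ⟩
    (coeff p n + coeff q n) + coeff r n  ≈⟨ +-assoc _ _ _ ⟩
    coeff p n + (coeff q n + coeff r n)  ≈⟨ +-congˡ (coeff-+ₚ q r n) ⟨
    coeff p n + coeff (q +ₚ r) n         ≈⟨ coeff-+ₚ p (q +ₚ r) n ⟨
    coeff (p +ₚ (q +ₚ r)) n             ∎

  +ₚ-interchange : ∀ p q r s → ((p +ₚ q) +ₚ (r +ₚ s)) ≋ ((p +ₚ r) +ₚ (q +ₚ s))
  +ₚ-interchange p q r s .at n = begin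
    coeff ((p +ₚ q) +ₚ (r +ₚ s)) n                     ≈⟨ coeff-+ₚ (p +ₚ q) (r +ₚ s) n ⟩
    coeff (p +ₚ q) n + coeff (r +ₚ s) n                 ≈⟨ +-cong (coeff-+ₚ p q n) (coeff-+ₚ r s n) ⟩
    (coeff p n + coeff q n) + (coeff r n + coeff s n)   ≈⟨ interchange _ _ _ _ ⟩
    (coeff p n + coeff r n) + (coeff q n + coeff s n)   ≈⟨ +-cong (coeff-+ₚ p r n) (coeff-+ₚ q s n) ⟨
    coeff (p +ₚ r) n + coeff (q +ₚ s) n                 ≈⟨ coeff-+ₚ (p +ₚ r) (q +ₚ s) n ⟨
    coeff ((p +ₚ r) +ₚ (q +ₚ s)) n                     ∎

  0∷-+ₚ : ∀ p q → (0# ∷ (p +ₚ q)) ≋ ((0# ∷ p) +ₚ (0# ∷ q))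
  0∷-+ₚ p q = ∷-cong (sym (+-identityʳ 0#)) ≋-refl

  -ₚ-inverseʳ : ∀ p q → ((p -ₚ q) +ₚ q) ≋ p
  -ₚ-inverseʳ p q .at n = begin
    coeff ((p -ₚ q) +ₚ q) n                  ≈⟨ coeff-+ₚ (p -ₚ q) q n ⟩
    coeff (p -ₚ q) n + coeff q n              ≈⟨ +-congʳ (coeff-+ₚ p (-ₚ q) n) ⟩
    (coeff p n + coeff (-ₚ q) n) + coeff q n  ≈⟨ +-congʳ (+-congˡ (coeff-negₚ q n)) ⟩
    (coeff p n + - coeff q n) + coeff q n     ≈⟨ +-assoc _ _ _ ⟩
    coeff p n + (- coeff q n + coeff q n)     ≈⟨ +-congˡ (-‿inverseˡ _) ⟩
    coeff p n + 0#                            ≈⟨ +-identityʳ _ ⟩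
    coeff p n                                 ∎

  scale-cong : ∀ {a b p q} → a ≈ b → p ≋ q → scale a p ≋ scale b q
  scale-cong {a} {b} {p} {q} e f .at n =
    trans (coeff-scale a p n) (trans (*-cong e (f .at n)) (sym (coeff-scale b q n)))

  scale-zeroˡ : ∀ p → scale 0# p ≋ []
  scale-zeroˡ p .at n = trans (coeff-scale 0# p n) (zeroˡ _)

  scale-identityˡ : ∀ p → scale 1# p ≋ p
  scale-identityˡ p .at n = trans (coeff-scale 1# p n) (*-identityˡ _)

  scale-distribˡ : ∀ a p q → scale a (p +ₚ q) ≋ (scale a p +ₚ scale a q)
  scale-distribˡ a p q .at n = begin
    coeff (scale a (p +ₚ q)) n                 ≈⟨ coeff-scale a (p +ₚ q) n ⟩
    a * coeff (p +ₚ q) n                       ≈⟨ *-congˡ (coeff-+ₚ p q n) ⟩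
    a * (coeff p n + coeff q n)                 ≈⟨ distribˡ a _ _ ⟩
    a * coeff p n + a * coeff q n               ≈⟨ +-cong (coeff-scale a p n) (coeff-scale a q n) ⟨
    coeff (scale a p) n + coeff (scale a q) n   ≈⟨ coeff-+ₚ (scale a p) (scale a q) n ⟨
    coeff (scale a p +ₚ scale a q) n           ∎

  scale-distribʳ : ∀ a b p → scale (a + b) p ≋ (scale a p +ₚ scale b p)
  scale-distribʳ a b p .at n = begin
    coeff (scale (a + b) p) n                   ≈⟨ coeff-scale (a + b) p n ⟩
    (a + b) * coeff p n                         ≈⟨ distribʳ _ a b ⟩
    a * coeff p n + b * coeff p n               ≈⟨ +-cong (coeff-scale a p n) (coeff-scale b p n) ⟨
    coeff (scale a p) n + coeff (scale b p) n   ≈⟨ coeff-+ₚ (scale a p) (scale b p) n ⟨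
    coeff (scale a p +ₚ scale b p) n           ∎

  scale-assoc : ∀ a b p → scale (a * b) p ≋ scale a (scale b p)
  scale-assoc a b p .at n = begin
    coeff (scale (a * b) p) n     ≈⟨ coeff-scale (a * b) p n ⟩
    (a * b) * coeff p n           ≈⟨ *-assoc a b _ ⟩
    a * (b * coeff p n)           ≈⟨ *-congˡ (coeff-scale b p n) ⟨
    a * coeff (scale b p) n       ≈⟨ coeff-scale a (scale b p) n ⟨
    coeff (scale a (scale b p)) n ∎

  *ₚ-congˡ : ∀ p {q q′} → q ≋ q′ → (p *ₚ q) ≋ (p *ₚ q′)
  *ₚ-congˡ []      e = ≋-refl
  *ₚ-congˡ (a ∷ p) e = +ₚ-cong (scale-cong refl e) (∷-cong refl (*ₚ-congˡ p e))

  *ₚ-distribʳ : ∀ p p′ q → ((p +ₚ p′) *ₚ q) ≋ ((p *ₚ q) +ₚ (p′ *ₚ q))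
  *ₚ-distribʳ []      p′       q = ≋-refl
  *ₚ-distribʳ (a ∷ p) []       q = ≋-sym (+ₚ-identityʳ _)
  *ₚ-distribʳ (a ∷ p) (a′ ∷ p′) q =
    ≋-trans (+ₚ-cong (scale-distribʳ a a′ q)
                     (≋-trans (∷-cong refl (*ₚ-distribʳ p p′ q)) (0∷-+ₚ (p *ₚ q) (p′ *ₚ q))))
            (+ₚ-interchange (scale a q) (scale a′ q) _ _)

  *ₚ-distribˡ : ∀ p q q′ → (p *ₚ (q +ₚ q′)) ≋ ((p *ₚ q) +ₚ (p *ₚ q′))
  *ₚ-distribˡ []      q q′ = ≋-refl
  *ₚ-distribˡ (a ∷ p) q q′ =
    ≋-trans (+ₚ-cong (scale-distribˡ a q q′)
                     (≋-trans (∷-cong refl (*ₚ-distribˡ p q q′)) (0∷-+ₚ (p *ₚ q) (p *ₚ q′))))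
            (+ₚ-interchange (scale a q) (scale a q′) _ _)

  scale-*ₚ : ∀ a p q → (scale a p *ₚ q) ≋ scale a (p *ₚ q)
  scale-*ₚ a []      q = ≋-refl
  scale-*ₚ a (b ∷ p) q =
    ≋-trans (+ₚ-cong (scale-assoc a b q) (∷-cong (sym (zeroʳ a)) (scale-*ₚ a p q)))
            (≋-sym (scale-distribˡ a (scale b q) (0# ∷ (p *ₚ q))))

  0∷-*ₚ : ∀ p q → ((0# ∷ p) *ₚ q) ≋ (0# ∷ (p *ₚ q))
  0∷-*ₚ p q = +ₚ-cong (scale-zeroˡ q) ≋-refl

  *ₚ-assoc : ∀ p q r → ((p *ₚ q) *ₚ r) ≋ (p *ₚ (q *ₚ r))
  *ₚ-assoc []      q r = ≋-refl
  *ₚ-assoc (a ∷ p) q r =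
    ≋-trans (*ₚ-distribʳ (scale a q) (0# ∷ (p *ₚ q)) r)
            (+ₚ-cong (scale-*ₚ a q r) (≋-trans (0∷-*ₚ (p *ₚ q) r) (∷-cong refl (*ₚ-assoc p q r))))

  const-*ₚ : ∀ a q → (const a *ₚ q) ≋ scale a q
  const-*ₚ a q .at n =
    trans (coeff-+ₚ (scale a q) (0# ∷ []) n) (trans (+-congˡ (sym ([]≋0∷[] .at n))) (+-identityʳ _))

  *ₚ-const : ∀ q a → (q *ₚ const a) ≋ scale a q
  *ₚ-const []      a = ≋-refl
  *ₚ-const (b ∷ q) a = ∷-cong (trans (+-identityʳ _) (*-comm b a)) (*ₚ-const q a)

  X-*ₚ : ∀ p → (X *ₚ p) ≋ (0# ∷ p)
  X-*ₚ p = +ₚ-cong (scale-zeroˡ p) (∷-cong refl (≋-trans (const-*ₚ 1# p) (scale-identityˡ p)))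

  infix 4 _≋_mod_
  record _≋_mod_ (p q g : Poly) : Set (c ⊔ ℓ) where
    constructor _,_
    field
      quotient   : Poly
      difference : p ≋ ((quotient *ₚ g) +ₚ q)

  module _ {g : Poly} where

    mod-refl : ∀ {p} → p ≋ p mod g
    mod-refl = [] , ≋-refl

    ≋-mod-trans : ∀ {p p′ q} → p ≋ p′ → p′ ≋ q mod g → p ≋ q mod g
    ≋-mod-trans e (h , f) = h , ≋-trans e f

    mod-≋-trans : ∀ {p q q′} → p ≋ q mod g → q ≋ q′ → p ≋ q′ mod g
    mod-≋-trans (h , f) e = h , ≋-trans f (+ₚ-cong ≋-refl e)

    mod-trans : ∀ {p q r} → p ≋ q mod g → q ≋ r mod g → p ≋ r mod g
    mod-trans {r = r} (h₁ , e₁) (h₂ , e₂) = (h₁ +ₚ h₂) ,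
      ≋-trans e₁ (≋-trans (+ₚ-cong ≋-refl e₂)
        (≋-trans (≋-sym (+ₚ-assoc (h₁ *ₚ g) (h₂ *ₚ g) r)) (+ₚ-cong (≋-sym (*ₚ-distribʳ h₁ h₂ g)) ≋-refl)))

    mod-+ₚ : ∀ {p₁ q₁ p₂ q₂} → p₁ ≋ q₁ mod g → p₂ ≋ q₂ mod g → (p₁ +ₚ p₂) ≋ (q₁ +ₚ q₂) mod g
    mod-+ₚ {q₁ = q₁} {q₂ = q₂} (h₁ , e₁) (h₂ , e₂) = (h₁ +ₚ h₂) ,
      ≋-trans (+ₚ-cong e₁ e₂) (≋-trans (+ₚ-interchange (h₁ *ₚ g) q₁ (h₂ *ₚ g) q₂)
        (+ₚ-cong (≋-sym (*ₚ-distribʳ h₁ h₂ g)) ≋-refl))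

    mod-*ₚˡ : ∀ s {p q} → p ≋ q mod g → (s *ₚ p) ≋ (s *ₚ q) mod g
    mod-*ₚˡ s {q = q} (h , e) = (s *ₚ h) ,
      ≋-trans (*ₚ-congˡ s e) (≋-trans (*ₚ-distribˡ s (h *ₚ g) q)
        (+ₚ-cong (≋-sym (*ₚ-assoc s h g)) ≋-refl))

    mod-∑ₚ : ∀ n {f f′ : Fin n → Poly} → (∀ i → f i ≋ f′ i mod g) → ∑ₚ n f ≋ ∑ₚ n f′ mod g
    mod-∑ₚ zero    e = mod-refl
    mod-∑ₚ (suc n) e = mod-+ₚ (e fzero) (mod-∑ₚ n (λ i → e (fsuc i)))

    compose-mod : ∀ {y x} → y ≋ const x mod g → ∀ t → compose t y ≋ const (eval t x) mod g
    compose-mod         y≡x []      = mod-≋-trans mod-refl []≋0∷[]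
    compose-mod {y} {x} y≡x (a ∷ t) =
      mod-+ₚ (mod-refl {const a})
        (mod-trans (mod-*ₚˡ y (compose-mod y≡x t))
          (≋-mod-trans (≋-trans (*ₚ-const y tx) (≋-sym (const-*ₚ tx y)))
                       (mod-≋-trans (mod-*ₚˡ (const tx) y≡x) const-*ₚ-const)))
      where
      tx = eval t x
      const-*ₚ-const : (const tx *ₚ const x) ≋ const (x * tx)
      const-*ₚ-const = ∷-cong (trans (+-identityʳ _) (*-comm tx x)) ≋-refl

  mod-sub-const : ∀ y x → y ≋ const x mod (y -ₚ const x)
  mod-sub-const y x = const 1# ,
    ≋-sym (≋-trans (+ₚ-cong (≋-trans (const-*ₚ 1# (y -ₚ const x)) (scale-identityˡ _)) ≋-refl)
                   (-ₚ-inverseʳ y (const x)))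

  ∑ₚ-cong : ∀ n {f f′ : Fin n → Poly} → (∀ i → f i ≋ f′ i) → ∑ₚ n f ≋ ∑ₚ n f′
  ∑ₚ-cong zero    e = ≋-refl
  ∑ₚ-cong (suc n) e = +ₚ-cong (e fzero) (∑ₚ-cong n (λ i → e (fsuc i)))

  ∑ₚ-0∷ : ∀ n (f : Fin n → Poly) → ∑ₚ n (λ i → 0# ∷ f i) ≋ (0# ∷ ∑ₚ n f)
  ∑ₚ-0∷ zero    f = []≋0∷[]
  ∑ₚ-0∷ (suc n) f = ≋-trans (+ₚ-cong ≋-refl (∑ₚ-0∷ n (λ i → f (fsuc i)))) (≋-sym (0∷-+ₚ (f fzero) _))

  ∑ₚ-X^-const : ∀ K (a : Fin K → Carrier) → ∑ₚ K (λ i → X^ (toℕ i) *ₚ const (a i)) ≋ fromCoeffs K a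
  ∑ₚ-X^-const zero    a = ≋-refl
  ∑ₚ-X^-const (suc K) a =
    ≋-trans (+ₚ-cong (≋-trans (const-*ₚ 1# (const (a fzero))) (scale-identityˡ _))
                     (≋-trans (∑ₚ-cong K (λ i → ≋-trans (*ₚ-assoc X (X^ (toℕ i)) _) (X-*ₚ _)))
                              (∑ₚ-0∷ K (λ i → X^ (toℕ i) *ₚ const (a (fsuc i))))))
            (∷-cong (+-identityʳ _) (∑ₚ-X^-const K (λ i → a (fsuc i))))

  fromCoeffs-degLT : ∀ K (a : Fin K → Carrier) → DegLT (fromCoeffs K a) K
  fromCoeffs-degLT zero    a n       _         = refl
  fromCoeffs-degLT (suc K) a (suc n) (s≤s K≤n) = fromCoeffs-degLT K (λ i → a (fsuc i)) n K≤n

  coeff-X^-same : ∀ i → coeff (X^ i) i ≈ 1#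
  coeff-X^-same zero    = refl
  coeff-X^-same (suc i) = trans (X-*ₚ (X^ i) .at (suc i)) (coeff-X^-same i)

  coeff-X^-other : ∀ i n → ¬ i ≡ n → coeff (X^ i) n ≈ 0#
  coeff-X^-other zero    zero    i≢n = ⊥-elim (i≢n ≡.refl)
  coeff-X^-other zero    (suc n) i≢n = refl
  coeff-X^-other (suc i) zero    i≢n = X-*ₚ (X^ i) .at zero
  coeff-X^-other (suc i) (suc n) i≢n =
    trans (X-*ₚ (X^ i) .at (suc n)) (coeff-X^-other i n (λ i≡n → i≢n (≡.cong suc i≡n)))

  HasDegree-unique : ∀ {p d e} → HasDegree p d → HasDegree p e → d ≡ e
  HasDegree-unique {d = d} {e} (pd≉0 , p<d+1) (pe≉0 , p<e+1) with ℕ.<-cmp d e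
  ... | tri< d<e _   _   = ⊥-elim (pe≉0 (p<d+1 e d<e))
  ... | tri≈ _   d≡e _   = d≡e
  ... | tri> _   _   e<d = ⊥-elim (pd≉0 (p<e+1 d e<d))

  coeff-X^-X-const : ∀ K x n → coeff ((X^ K -ₚ X) -ₚ const x) (suc (suc n)) ≈ coeff (X^ K) (suc (suc n))
  coeff-X^-X-const K x n = begin
    coeff (Y -ₚ const x) n+2                           ≈⟨ coeff-+ₚ Y (-ₚ const x) n+2 ⟩
    coeff Y n+2 + coeff (-ₚ const x) n+2               ≈⟨ +-cong (coeff-+ₚ (X^ K) (-ₚ X) n+2) (coeff-negₚ (const x) n+2) ⟩
    (coeff (X^ K) n+2 + coeff (-ₚ X) n+2) + - 0#       ≈⟨ +-cong (+-congˡ (coeff-negₚ X n+2)) -0#≈0# ⟩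
    (coeff (X^ K) n+2 + - 0#) + 0#                     ≈⟨ +-identityʳ _ ⟩
    coeff (X^ K) n+2 + - 0#                            ≈⟨ +-congˡ -0#≈0# ⟩
    coeff (X^ K) n+2 + 0#                              ≈⟨ +-identityʳ _ ⟩
    coeff (X^ K) n+2                                   ∎
    where
    Y = X^ K -ₚ X
    n+2 = suc (suc n)

  X^-X-const-hasDegree : ∀ {K} → 2 ≤ K → ∀ x → HasDegree ((X^ K -ₚ X) -ₚ const x) K
  X^-X-const-hasDegree {K@(suc (suc k))} (s≤s (s≤s _)) x = leading≉0 , vanishes-above
    where
    leading≉0 : ¬ coeff ((X^ K -ₚ X) -ₚ const x) K ≈ 0#
    leading≉0 G≈0 = 1≉0 (trans (sym (trans (coeff-X^-X-const K x k) (coeff-X^-same K))) G≈0)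
    vanishes-above : DegLT ((X^ K -ₚ X) -ₚ const x) (suc K)
    vanishes-above (suc (suc n)) K<n+2@(s≤s (s≤s _)) =
      trans (coeff-X^-X-const K x n) (coeff-X^-other K (suc (suc n)) (ℕ.<⇒≢ K<n+2))

  mod-isRemainder : ∀ {f g r K} → f ≋ r mod g → HasDegree g K → DegLT r K → IsRemainder f g r
  mod-isRemainder {g = g} {r} (h , f≋hg+r) g-deg r<K =
    (h , f≋hg+r .at) , λ d g-deg′ → ≡.subst (DegLT r) (HasDegree-unique {g} g-deg g-deg′) r<K

  gaoMateer-remainder : ∀ {K} → 2 ≤ K → ∀ x (t : Fin K → Poly) (r : Fin K → Carrier) →
    (∀ i → eval (t i) x ≈ r i) →
    IsRemainder (∑ₚ K (λ i → X^ (toℕ i) *ₚ compose (t i) (X^ K -ₚ X)))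
                ((X^ K -ₚ X) -ₚ const x) (fromCoeffs K r)
  gaoMateer-remainder {K} 2≤K x t r t[x]≈r =
    mod-isRemainder
      (mod-≋-trans (mod-∑ₚ K λ i → mod-*ₚˡ (X^ (toℕ i)) (t[Y]≡r i)) (∑ₚ-X^-const K r))
      (X^-X-const-hasDegree 2≤K x)
      (fromCoeffs-degLT K r)
    where
    t[Y]≡r : ∀ i → compose (t i) (X^ K -ₚ X) ≋ const (r i) mod ((X^ K -ₚ X) -ₚ const x)
    t[Y]≡r i = mod-≋-trans (compose-mod (mod-sub-const (X^ K -ₚ X) x) (t i)) (∷-cong (t[x]≈r i) ≋-refl)

lemma3p2 : ∀ {c ℓ} (F : Field c ℓ) → let open Field F in let open FieldTheory F in
    (L m : ℕ) → 1 < m → m ≤ 2 ^ L →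
    (β : Fin (2 ^ L) → Carrier) → IsCantorBasis (2 ^ L) β →
    (b : Carrier) → InW (2 ^ L) β (2 ^ L) b → ¬ InW (2 ^ L) β (m ∸ half m) b →
    (r : Fin (2 ^ (m ∸ half m)) → Fin (2 ^ half m) → Carrier) →
    (t : Fin (2 ^ half m) → Poly) →
    (∀ i → DegLT (t i) (2 ^ half m)) →
    (∀ i j → eval (t i) (b + ϖ (2 ^ L) β (toℕ j)) ≈ r j i) →
    ∀ j → IsRemainder
            (∑ₚ (2 ^ half m) (λ i → X^ (toℕ i) *ₚ compose (t i) (X^ (2 ^ half m) -ₚ X)))
            ((X^ (2 ^ half m) -ₚ X) -ₚ const (b + ϖ (2 ^ L) β (toℕ j)))
            (fromCoeffs (2 ^ half m) (r j))
lemma3p2 F L m _ _ β _ b _ _ r t _ t[b+ϖ]≈r j =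
  Polynomials.gaoMateer-remainder F 2≤2^half (b + ϖ (2 ^ L) β (toℕ j)) t (r j) (λ i → t[b+ϖ]≈r i j)
  where
  open Field F using (_+_)
  open FieldTheory F using (ϖ)
  2≤2^half : 2 ≤ 2 ^ half m
  2≤2^half = ℕ.^-monoʳ-≤ 2 (ℕ.m^n>0 2 (ℓ-of m ∸ 1))
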